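{- Let $\xi\in\mathcal A$. Then there are unique elements $\xi_S\in\pi_S\mathcal R$ and $\xi_U\in\pi_U\mathcal R$ such that $\xi\pi_S-\xi_S\in\pi_U\mathcal R$ and $\xi\pi_U-\xi_U\in\pi_S\mathcal R$. The map $P:\mathcal A\to\mathcal A$, $P(\xi)=\xi-\xi_S-\xi_U$, is a projection onto $\mathcal B$, and the image of $\mathcal I$ under $P$ is $\mathcal J=\pi_S\mathcal R(1-\pi_S)+\pi_U\mathcal R(1-\pi_U)$.
   Context: Let $\Gamma=\mathrm{PSL}_2(\mathbb Z)$, $S=\pm\begin{pmatrix}0&-1\\1&0\end{pmatrix}$, $U=\pm\begin{pmatrix}1&-1\\1&0\end{pmatrix}$. Let $\mathcal M$ be the set of $2\times2$ integer matrices of positive determinant modulo $\{\pm1\}$ and $\mathcal R=\mathbb Q[\mathcal M]$ the $\mathbb Q$-algebra of formal finite linear combinations, with multiplication the bilinear extension of matrix multiplication; $\mathbb Q[\Gamma]\subset\mathcal R$ and $1$ is the identity matrix. Put $\pi_S=(1+S)/2$, $\pi_U=(1+U+U^2)/3$, and $\mathcal I=\pi_S\mathcal R+\pi_U\mathcal R$, $\mathcal A=\{\xi\in\mathcal R:\xi\pi_S\in\mathcal I,\ \xi\pi_U\in\mathcal I\}$, $\mathcal B=\{\xi\in\mathcal R:\xi\pi_S\in\pi_U\mathcal R,\ \xi\pi_U\in\pi_S\mathcal R\}$. -}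

module Defs where

open import Data.Bool using (Bool; true; false; _∧_; _∨_; if_then_else_)
open import Data.Integer as ℤ using (ℤ; +_; -[1+_]; 0ℤ; _<_)
import Data.Integer.Properties as ℤP
open import Data.Integer.Solver using (module +-*-Solver)
open import Data.List using (List; []; _∷_; _++_; map; concatMap)
open import Data.Product using (_×_; _,_; Σ; ∃; ∃-syntax; proj₁; proj₂)
open import Data.Rational as ℚ using (ℚ; 0ℚ; 1ℚ)
open import Relation.Nullary.Decidable using (⌊_⌋)
open import Relation.Binary.PropositionalEquality using (_≡_; refl; sym; subst)

det : ℤ → ℤ → ℤ → ℤ → ℤ
det a b c d = a ℤ.* d ℤ.- b ℤ.* c

record Mat : Set where
  constructor mat
  field
    a b c d : ℤ
    detPos  : 0ℤ < det a b c d

private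
  det-mul : ∀ a b c d e f g h →
    det (a ℤ.* e ℤ.+ b ℤ.* g) (a ℤ.* f ℤ.+ b ℤ.* h)
        (c ℤ.* e ℤ.+ d ℤ.* g) (c ℤ.* f ℤ.+ d ℤ.* h)
      ≡ det a b c d ℤ.* det e f g h
  det-mul = +-*-Solver.solve 8
    (λ a b c d e f g h →
      ((a :* e :+ b :* g) :* (c :* f :+ d :* h)) :- ((a :* f :+ b :* h) :* (c :* e :+ d :* g))
      := (a :* d :- b :* c) :* (e :* h :- f :* g))
    refl
    where open +-*-Solver

  pos*pos : ∀ {x y} → 0ℤ < x → 0ℤ < y → 0ℤ < x ℤ.* y
  pos*pos {x} {y} 0<x 0<y =
    subst (_< x ℤ.* y) (ℤP.*-zeroʳ x)
      (ℤP.*-monoˡ-<-pos x {{ℤ.positive 0<x}} 0<y)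

_·_ : Mat → Mat → Mat
mat a b c d p · mat e f g h q =
  mat (a ℤ.* e ℤ.+ b ℤ.* g) (a ℤ.* f ℤ.+ b ℤ.* h)
      (c ℤ.* e ℤ.+ d ℤ.* g) (c ℤ.* f ℤ.+ d ℤ.* h)
      (subst (0ℤ <_) (sym (det-mul a b c d e f g h)) (pos*pos p q))

infixl 7 _·_

-- equality in 𝓜 = matrices modulo {±1} (decidable, as a Boolean)
_=ℤ_ : ℤ → ℤ → Bool
infix 7 _=ℤ_
x =ℤ y = ⌊ x ℤ.≟ y ⌋

sameM : Mat → Mat → Bool
sameM (mat a b c d _) (mat a' b' c' d' _) =
  (a =ℤ a' ∧ b =ℤ b' ∧ c =ℤ c' ∧ d =ℤ d')
  ∨ (a =ℤ (ℤ.- a') ∧ b =ℤ (ℤ.- b') ∧ c =ℤ (ℤ.- c') ∧ d =ℤ (ℤ.- d'))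

I₂ S U : Mat
I₂ = mat (+ 1) (+ 0) (+ 0) (+ 1) (ℤ.+<+ (Data.Nat.s≤s Data.Nat.z≤n))
  where import Data.Nat
S  = mat (+ 0) -[1+ 0 ] (+ 1) (+ 0) (ℤ.+<+ (Data.Nat.s≤s Data.Nat.z≤n))
  where import Data.Nat
U  = mat (+ 1) -[1+ 0 ] (+ 1) (+ 0) (ℤ.+<+ (Data.Nat.s≤s Data.Nat.z≤n))
  where import Data.Nat

-- 𝓡 = ℚ[𝓜]: formal finite ℚ-linear combinations, represented by lists
-- of (coefficient, matrix) terms; equality is equality of coefficients.

R : Set
R = List (ℚ × Mat)

coeff : R → Mat → ℚ
coeff []             m = 0ℚ
coeff ((q , n) ∷ ξ)  m = (if sameM n m then q else 0ℚ) ℚ.+ coeff ξ m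

_≈_ : R → R → Set
ξ ≈ η = ∀ m → coeff ξ m ≡ coeff η m

infix 4 _≈_

0R : R
0R = []

ι : Mat → R
ι m = (1ℚ , m) ∷ []

1R : R
1R = ι I₂

_⊕_ : R → R → R
_⊕_ = _++_

scale : ℚ → R → R
scale q = map (λ t → (q ℚ.* proj₁ t , proj₂ t))

⊖_ : R → R
⊖ ξ = scale (ℚ.- 1ℚ) ξ

_⊝_ : R → R → R
ξ ⊝ η = ξ ⊕ (⊖ η)

_⊛_ : R → R → R
ξ ⊛ η = concatMap (λ s → map (λ t → (proj₁ s ℚ.* proj₁ t , proj₂ s · proj₂ t)) η) ξ

infixl 7 _⊛_
infixl 6 _⊕_ _⊝_

πS : R
πS = scale (+ 1 ℚ./ 2) (ι I₂ ⊕ ι S)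

πU : R
πU = scale (+ 1 ℚ./ 3) (ι I₂ ⊕ ι U ⊕ ι (U · U))

_∈_𝓡 : R → R → Set
x ∈ π 𝓡 = ∃[ η ] x ≈ π ⊛ η

𝓘 : R → Set
𝓘 x = ∃[ η₁ ] ∃[ η₂ ] x ≈ πS ⊛ η₁ ⊕ πU ⊛ η₂

𝓙 : R → Set
𝓙 x = ∃[ η₁ ] ∃[ η₂ ] x ≈ πS ⊛ η₁ ⊛ (1R ⊝ πS) ⊕ πU ⊛ η₂ ⊛ (1R ⊝ πU)

𝓐 : R → Set
𝓐 ξ = 𝓘 (ξ ⊛ πS) × 𝓘 (ξ ⊛ πU)

𝓑 : R → Set
𝓑 ξ = (ξ ⊛ πS) ∈ πU 𝓡 × (ξ ⊛ πU) ∈ πS 𝓡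

IsDecomp : R → R → R → Set
IsDecomp ξ ξS ξU =
  ξS ∈ πS 𝓡 × ξU ∈ πU 𝓡 ×
  (ξ ⊛ πS ⊝ ξS) ∈ πU 𝓡 × (ξ ⊛ πU ⊝ ξU) ∈ πS 𝓡

-- Everything but one fact is ring theory, valid for idempotents e, f of any ring 𝑅 with
-- e𝑅 ∩ f𝑅 = 0: writing ξe = eα₁ + fα₂ and ξf = eβ₁ + fβ₂ gives ξ_S = eα₁ and ξ_U = fβ₂; two
-- decompositions differ by elements of e𝑅 ∩ f𝑅, whence uniqueness; and uniqueness applied to
-- (ξ_S e, ξ_U f) gives ξ_S e = ξ_S and ξ_U f = ξ_U, which puts P(ξ) into 𝓑.
-- The remaining fact is πS𝓡 ∩ πU𝓡 = 0. An element x of both satisfies S x = x = U x, so its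
-- coefficient function is invariant under m ↦ (SU)² m = [[1,0],[-2,1]] m. As det m > 0, the first
-- row of m is nonzero, so the orbit of m under this shear leaves every finite set, and the
-- coefficient of x at m equals one outside the support of x, i.e. zero.
-- 𝓡 with coefficientwise equality is indeed a ring; its one delicate law, the congruence of the
-- product, rests on cancellation in 𝓜.

module Submission where

open import Algebra.Bundles using (Ring)
open import Data.Product using (_×_; _,_; Σ; ∃-syntax; proj₁; proj₂)
open import Level using (_⊔_; 0ℓ)

-- Right ideals generated by idempotents

module RightIdeals {c ℓ} (𝐑 : Ring c ℓ) where

  open Ring 𝐑
  open import Algebra.Properties.Ring 𝐑
  open import Algebra.Properties.CommutativeSemigroup +-commutativeSemigroup
    using (interchange; xy∙z≈xz∙y)
  open import Relation.Binary.Reasoning.Setoid setoid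

  infix 4 _∈_𝑅

  _∈_𝑅 : Carrier → Carrier → Set (c ⊔ ℓ)
  x ∈ π 𝑅 = ∃[ η ] x ≈ π * η

  ∈𝑅-resp-≈ : ∀ {π x y} → x ≈ y → y ∈ π 𝑅 → x ∈ π 𝑅
  ∈𝑅-resp-≈ x≈y (η , y≈πη) = η , trans x≈y y≈πη

  *-∈𝑅 : ∀ π x → π * x ∈ π 𝑅
  *-∈𝑅 π x = x , refl

  0∈𝑅 : ∀ π → 0# ∈ π 𝑅
  0∈𝑅 π = 0# , sym (zeroʳ π)

  ∈𝑅-*ʳ : ∀ {π x} y → x ∈ π 𝑅 → x * y ∈ π 𝑅
  ∈𝑅-*ʳ {π} y (η , x≈πη) = η * y , trans (*-congʳ x≈πη) (*-assoc π η y)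

  ∈𝑅-- : ∀ {π x y} → x ∈ π 𝑅 → y ∈ π 𝑅 → x - y ∈ π 𝑅
  ∈𝑅-- {π} (η , x≈πη) (η′ , y≈πη′) =
    η - η′ , trans (+-cong x≈πη (-‿cong y≈πη′)) (sym (x[y-z]≈xy-xz π η η′))

  *-fixes-∈𝑅 : ∀ {g π} x → g * π ≈ π → x ∈ π 𝑅 → g * x ≈ x
  *-fixes-∈𝑅 {g} {π} x gπ≈π (η , x≈πη) = begin
    g * x        ≈⟨ *-congˡ x≈πη ⟩
    g * (π * η)  ≈⟨ *-assoc g π η ⟨
    g * π * η    ≈⟨ *-congʳ gπ≈π ⟩
    π * η        ≈⟨ x≈πη ⟨
    x            ∎

  x≈y+z⇒x-y≈z : ∀ {x y z} → x ≈ y + z → x - y ≈ z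
  x≈y+z⇒x-y≈z {y = y} {z} x≈y+z = trans (+-congʳ x≈y+z) (xyx⁻¹≈y y z)

  x≈y+z⇒x-z≈y : ∀ {x y z} → x ≈ y + z → x - z ≈ y
  x≈y+z⇒x-z≈y {y = y} {z} x≈y+z = trans (+-congʳ x≈y+z) (//-rightDividesʳ z y)

  [z-y]-[z-x]≈x-y : ∀ x y z → (z - y) - (z - x) ≈ x - y
  [z-y]-[z-x]≈x-y x y z = begin
    (z - y) - (z - x)    ≈⟨ +-congˡ (⁻¹-anti-homo‿- z x) ⟩
    (z - y) + (x - z)    ≈⟨ +-comm (z - y) (x - z) ⟩
    (x - z) + (z - y)    ≈⟨ +-assoc x (- z) (z - y) ⟩
    x + (- z + (z - y))  ≈⟨ +-congˡ (+-assoc (- z) z (- y)) ⟨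
    x + ((- z + z) - y)  ≈⟨ +-congˡ (+-congʳ (-‿inverseˡ z)) ⟩
    x + (0# - y)         ≈⟨ +-congˡ (+-identityˡ (- y)) ⟩
    x - y                ∎

  x-0≈x : ∀ x → x - 0# ≈ x
  x-0≈x x = trans (+-congˡ -0#≈0#) (+-identityʳ x)

  [x+y]-z-w≈[x-z]+[y-w] : ∀ x y z w → (x + y) - z - w ≈ (x - z) + (y - w)
  [x+y]-z-w≈[x-z]+[y-w] x y z w =
    trans (+-assoc (x + y) (- z) (- w)) (interchange x y (- z) (- w))

  x-y-z≈x-z-y : ∀ x y z → x - y - z ≈ x - z - y
  x-y-z≈x-z-y x y z = xy∙z≈xz∙y x (- y) (- z)

  [x-y]*z≈x-y*z : ∀ {x y z} → x * z ≈ x → (x - y) * z ≈ x - y * z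
  [x-y]*z≈x-y*z {x} {y} {z} xz≈x = trans ([y-z]x≈yx-zx z x y) (+-congʳ xz≈x)

  π*x-π*x*π≈π*x*[1-π] : ∀ π x → π * x - π * x * π ≈ π * x * (1# - π)
  π*x-π*x*π≈π*x*[1-π] π x =
    sym (trans (x[y-z]≈xy-xz (π * x) 1# π) (+-congʳ (*-identityʳ (π * x))))

  [1-π]*π≈0 : ∀ {π} → π * π ≈ π → (1# - π) * π ≈ 0#
  [1-π]*π≈0 {π} π*π≈π = trans ([y-z]x≈yx-zx π 1# π)
    (trans (+-cong (*-identityˡ π) (-‿cong π*π≈π)) (-‿inverseʳ π))

  π*x*[1-π]*π≈0 : ∀ {π} x → π * π ≈ π → π * x * (1# - π) * π ≈ 0#
  π*x*[1-π]*π≈0 {π} x π*π≈π =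
    trans (*-assoc (π * x) (1# - π) π) (trans (*-congˡ ([1-π]*π≈0 π*π≈π)) (zeroʳ (π * x)))

  -- ℐ, 𝒥, 𝒜, ℬ and Decomposition are the 𝓘, 𝓙, 𝓐, 𝓑 and IsDecomp of the statement, for idempotents
  -- e, f in place of πS, πU.
  module TwoIdempotents (e f : Carrier) (e*e≈e : e * e ≈ e) (f*f≈f : f * f ≈ f)
                        (e𝑅∩f𝑅≈0 : ∀ x → x ∈ e 𝑅 → x ∈ f 𝑅 → x ≈ 0#) where

    ℐ : Carrier → Set (c ⊔ ℓ)
    ℐ x = ∃[ η₁ ] ∃[ η₂ ] x ≈ e * η₁ + f * η₂

    𝒥 : Carrier → Set (c ⊔ ℓ)
    𝒥 x = ∃[ η₁ ] ∃[ η₂ ] x ≈ e * η₁ * (1# - e) + f * η₂ * (1# - f)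

    𝒜 : Carrier → Set (c ⊔ ℓ)
    𝒜 ξ = ℐ (ξ * e) × ℐ (ξ * f)

    ℬ : Carrier → Set (c ⊔ ℓ)
    ℬ ξ = (ξ * e) ∈ f 𝑅 × (ξ * f) ∈ e 𝑅

    Decomposition : Carrier → Carrier → Carrier → Set (c ⊔ ℓ)
    Decomposition ξ ξe ξf =
      ξe ∈ e 𝑅 × ξf ∈ f 𝑅 × (ξ * e - ξe) ∈ f 𝑅 × (ξ * f - ξf) ∈ e 𝑅

    decompose : ∀ {ξ} → 𝒜 ξ → Carrier × Carrier
    decompose ((α₁ , _ , _) , (_ , β₂ , _)) = e * α₁ , f * β₂

    decompose-correct : ∀ {ξ} (a : 𝒜 ξ) →
                        Decomposition ξ (proj₁ (decompose a)) (proj₂ (decompose a))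
    decompose-correct ((α₁ , α₂ , ξe≈) , (β₁ , β₂ , ξf≈)) =
      *-∈𝑅 e α₁ , *-∈𝑅 f β₂ , (α₂ , x≈y+z⇒x-y≈z ξe≈) , (β₁ , x≈y+z⇒x-z≈y ξf≈)

    -- x - x′ lies in e𝑅, and in f𝑅 as (ξe - x′) - (ξe - x).
    decomposition-unique : ∀ {ξ x y x′ y′} → Decomposition ξ x y → Decomposition ξ x′ y′ →
                           x ≈ x′ × y ≈ y′
    decomposition-unique {ξ} {x} {y} {x′} {y′}
                         (x∈ , y∈ , ξe-x∈ , ξf-y∈) (x′∈ , y′∈ , ξe-x′∈ , ξf-y′∈) =
      x∙y⁻¹≈ε⇒x≈y x x′ (e𝑅∩f𝑅≈0 _ (∈𝑅-- x∈ x′∈)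
        (∈𝑅-resp-≈ (sym ([z-y]-[z-x]≈x-y x x′ (ξ * e))) (∈𝑅-- ξe-x′∈ ξe-x∈))) ,
      x∙y⁻¹≈ε⇒x≈y y y′ (e𝑅∩f𝑅≈0 _
        (∈𝑅-resp-≈ (sym ([z-y]-[z-x]≈x-y y y′ (ξ * f))) (∈𝑅-- ξf-y′∈ ξf-y∈)) (∈𝑅-- y∈ y′∈))

    decomposition-*ʳ : ∀ {ξ x y} → Decomposition ξ x y → Decomposition ξ (x * e) (y * f)
    decomposition-*ʳ {ξ} (x∈ , y∈ , ξe-x∈ , ξf-y∈) =
      ∈𝑅-*ʳ e x∈ , ∈𝑅-*ʳ f y∈ ,
      ∈𝑅-resp-≈ (sym ([x-y]*z≈x-y*z ξe*e≈ξe)) (∈𝑅-*ʳ e ξe-x∈) ,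
      ∈𝑅-resp-≈ (sym ([x-y]*z≈x-y*z ξf*f≈ξf)) (∈𝑅-*ʳ f ξf-y∈)
      where
      ξe*e≈ξe : ξ * e * e ≈ ξ * e
      ξe*e≈ξe = trans (*-assoc ξ e e) (*-congˡ e*e≈e)
      ξf*f≈ξf : ξ * f * f ≈ ξ * f
      ξf*f≈ξf = trans (*-assoc ξ f f) (*-congˡ f*f≈f)

    P : (ξ : Carrier) → 𝒜 ξ → Carrier
    P ξ a = ξ - proj₁ (decompose a) - proj₂ (decompose a)

    P≈ : ∀ {ξ x y} (a : 𝒜 ξ) → Decomposition ξ x y → P ξ a ≈ ξ - x - y
    P≈ a d with decomposition-unique (decompose-correct a) d
    ... | xₐ≈x , yₐ≈y = +-cong (+-congˡ (-‿cong xₐ≈x)) (-‿cong yₐ≈y)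

    decomposition⇒xe≈x×yf≈y : ∀ {ξ x y} → Decomposition ξ x y → x * e ≈ x × y * f ≈ y
    decomposition⇒xe≈x×yf≈y d with decomposition-unique d (decomposition-*ʳ d)
    ... | x≈xe , y≈yf = sym x≈xe , sym y≈yf

    decomposition⇒ℬ : ∀ {ξ x y} → Decomposition ξ x y → ℬ (ξ - x - y)
    decomposition⇒ℬ {ξ} {x} {y} d@(x∈ , y∈ , ξe-x∈ , ξf-y∈) =
      ∈𝑅-resp-≈ ξ-x-y*e≈ (∈𝑅-- ξe-x∈ (∈𝑅-*ʳ e y∈)) ,
      ∈𝑅-resp-≈ ξ-x-y*f≈ (∈𝑅-- ξf-y∈ (∈𝑅-*ʳ f x∈))
      where
      ξ-x-y*e≈ : (ξ - x - y) * e ≈ (ξ * e - x) - y * e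
      ξ-x-y*e≈ = begin
        (ξ - x - y) * e          ≈⟨ [y-z]x≈yx-zx e (ξ - x) y ⟩
        (ξ - x) * e - y * e      ≈⟨ +-congʳ ([y-z]x≈yx-zx e ξ x) ⟩
        (ξ * e - x * e) - y * e  ≈⟨ +-congʳ (+-congˡ (-‿cong (proj₁ (decomposition⇒xe≈x×yf≈y d)))) ⟩
        (ξ * e - x) - y * e      ∎
      ξ-x-y*f≈ : (ξ - x - y) * f ≈ (ξ * f - y) - x * f
      ξ-x-y*f≈ = begin
        (ξ - x - y) * f          ≈⟨ *-congʳ (x-y-z≈x-z-y ξ x y) ⟩
        (ξ - y - x) * f          ≈⟨ [y-z]x≈yx-zx f (ξ - y) x ⟩
        (ξ - y) * f - x * f      ≈⟨ +-congʳ ([y-z]x≈yx-zx f ξ y) ⟩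
        (ξ * f - y * f) - x * f  ≈⟨ +-congʳ (+-congˡ (-‿cong (proj₂ (decomposition⇒xe≈x×yf≈y d)))) ⟩
        (ξ * f - y) - x * f      ∎

    P-ℬ : ∀ {ξ} (a : 𝒜 ξ) → ℬ (P ξ a)
    P-ℬ a = decomposition⇒ℬ (decompose-correct a)

    ℬ⇒𝒜 : ∀ {ξ} → ℬ ξ → 𝒜 ξ
    ℬ⇒𝒜 ((η , ξe≈) , (η′ , ξf≈)) =
      (0# , η , trans ξe≈ (sym (trans (+-congʳ (zeroʳ e)) (+-identityˡ (f * η))))) ,
      (η′ , 0# , trans ξf≈ (sym (trans (+-congˡ (zeroʳ f)) (+-identityʳ (e * η′)))))

    ℬ⇒decomposition-0 : ∀ {ξ} → ℬ ξ → Decomposition ξ 0# 0#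
    ℬ⇒decomposition-0 {ξ} (ξe∈ , ξf∈) =
      0∈𝑅 e , 0∈𝑅 f , ∈𝑅-resp-≈ (x-0≈x (ξ * e)) ξe∈ , ∈𝑅-resp-≈ (x-0≈x (ξ * f)) ξf∈

    P-fixes-ℬ : ∀ {ξ} → ℬ ξ → (a : 𝒜 ξ) → P ξ a ≈ ξ
    P-fixes-ℬ {ξ} b a = trans (P≈ a (ℬ⇒decomposition-0 b)) (trans (x-0≈x (ξ - 0#)) (x-0≈x ξ))

    P-idem : ∀ {ξ} (a : 𝒜 ξ) (a′ : 𝒜 (P ξ a)) → P (P ξ a) a′ ≈ P ξ a
    P-idem a = P-fixes-ℬ (P-ℬ a)

    ℐ-decomposition : ∀ {ξ x y} → ξ ≈ e * x + f * y → Decomposition ξ (e * x * e) (f * y * f)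
    ℐ-decomposition {ξ} {x} {y} ξ≈ =
      ∈𝑅-*ʳ e (*-∈𝑅 e x) , ∈𝑅-*ʳ f (*-∈𝑅 f y) ,
      ∈𝑅-resp-≈ (x≈y+z⇒x-y≈z (ξ*≈ e)) (∈𝑅-*ʳ e (*-∈𝑅 f y)) ,
      ∈𝑅-resp-≈ (x≈y+z⇒x-z≈y (ξ*≈ f)) (∈𝑅-*ʳ f (*-∈𝑅 e x))
      where
      ξ*≈ : ∀ z → ξ * z ≈ e * x * z + f * y * z
      ξ*≈ z = trans (*-congʳ ξ≈) (distribʳ z (e * x) (f * y))

    ℐ⇒𝒜 : ∀ {ξ} → ℐ ξ → 𝒜 ξ
    ℐ⇒𝒜 {ξ} (x , y , ξ≈) = ξ*∈ℐ e , ξ*∈ℐ f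
      where
      ξ*∈ℐ : ∀ z → ℐ (ξ * z)
      ξ*∈ℐ z = x * z , y * z ,
        trans (*-congʳ ξ≈) (trans (distribʳ z (e * x) (f * y)) (+-cong (*-assoc e x z) (*-assoc f y z)))

    P-ℐ : ∀ {ξ} → ℐ ξ → (a : 𝒜 ξ) → 𝒥 (P ξ a)
    P-ℐ {ξ} (x , y , ξ≈) a = x , y , (begin
      P ξ a                                          ≈⟨ P≈ a (ℐ-decomposition ξ≈) ⟩
      ξ - e * x * e - f * y * f                      ≈⟨ +-congʳ (+-congʳ ξ≈) ⟩
      (e * x + f * y) - e * x * e - f * y * f
        ≈⟨ [x+y]-z-w≈[x-z]+[y-w] (e * x) (f * y) (e * x * e) (f * y * f) ⟩
      (e * x - e * x * e) + (f * y - f * y * f)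
        ≈⟨ +-cong (π*x-π*x*π≈π*x*[1-π] e x) (π*x-π*x*π≈π*x*[1-π] f y) ⟩
      e * x * (1# - e) + f * y * (1# - f)            ∎)

    𝒥⇒ℐ : ∀ {η} → 𝒥 η → ℐ η
    𝒥⇒ℐ (x , y , η≈) =
      x * (1# - e) , y * (1# - f) , trans η≈ (+-cong (*-assoc e x (1# - e)) (*-assoc f y (1# - f)))

    𝒥⇒ℬ : ∀ {η} → 𝒥 η → ℬ η
    𝒥⇒ℬ {η} (x , y , η≈) =
      ∈𝑅-resp-≈ ηe≈ (∈𝑅-*ʳ e (∈𝑅-*ʳ (1# - f) (*-∈𝑅 f y))) ,
      ∈𝑅-resp-≈ ηf≈ (∈𝑅-*ʳ f (∈𝑅-*ʳ (1# - e) (*-∈𝑅 e x)))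
      where
      η*≈ : ∀ z → η * z ≈ e * x * (1# - e) * z + f * y * (1# - f) * z
      η*≈ z = trans (*-congʳ η≈) (distribʳ z (e * x * (1# - e)) (f * y * (1# - f)))
      ηe≈ : η * e ≈ f * y * (1# - f) * e
      ηe≈ = trans (η*≈ e) (trans (+-congʳ (π*x*[1-π]*π≈0 x e*e≈e)) (+-identityˡ (f * y * (1# - f) * e)))
      ηf≈ : η * f ≈ e * x * (1# - e) * f
      ηf≈ = trans (η*≈ f) (trans (+-congˡ (π*x*[1-π]*π≈0 y f*f≈f)) (+-identityʳ (e * x * (1# - e) * f)))


open import Defs
open import Algebra.Structures using (IsRing)
open import Data.Bool using (Bool; true; false; T; _∧_; _∨_; if_then_else_)
open import Data.Bool.Properties using (T-≡; T-∧; T-∨; ⇔→≡)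
open import Data.Empty using (⊥; ⊥-elim)
open import Data.Integer as ℤ using (ℤ; +_; 0ℤ; ∣_∣)
import Data.Integer.Properties as ℤP
import Data.Integer.Solver as ℤSolver
import Data.List
open Data.List using ([]; _∷_; _++_)
open import Data.List.Properties using (++-assoc; ++-identityʳ)
open import Data.Nat as ℕ using (ℕ; zero; suc)
import Data.Nat.Properties as ℕP
open import Data.Rational as ℚ using (ℚ; 0ℚ; 1ℚ)
import Data.Rational.Properties as ℚP
import Data.Rational.Solver as ℚSolver
open import Data.Sum using (_⊎_; inj₁; inj₂)
open import Function using (_⇔_; mk⇔; Equivalence; _∘_)
open import Relation.Binary.PropositionalEquality
open import Relation.Nullary using (¬_; yes; no)
open import Relation.Nullary.Decidable using (toWitness; fromWitness)

-- Matrices up to sign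

ℤ⁴ : Set
ℤ⁴ = ℤ × ℤ × ℤ × ℤ

entries : Mat → ℤ⁴
entries m = Mat.a m , Mat.b m , Mat.c m , Mat.d m

-- entries (s · t) reduces to entries s ∙⁴ entries t, so laws of _·_ are laws of _∙⁴_.
infixl 7 _∙⁴_

_∙⁴_ : ℤ⁴ → ℤ⁴ → ℤ⁴
(a , b , c , d) ∙⁴ (e , f , g , h) =
  a ℤ.* e ℤ.+ b ℤ.* g , a ℤ.* f ℤ.+ b ℤ.* h , c ℤ.* e ℤ.+ d ℤ.* g , c ℤ.* f ℤ.+ d ℤ.* h

-⁴_ : ℤ⁴ → ℤ⁴
-⁴ (a , b , c , d) = ℤ.- a , ℤ.- b , ℤ.- c , ℤ.- d

infix 4 _∼_

data _∼_ (n m : Mat) : Set where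
  same     : entries n ≡ entries m → n ∼ m
  opposite : entries n ≡ -⁴ entries m → n ∼ m

≡⁴ : ∀ {a b c d a′ b′ c′ d′ : ℤ} → a ≡ a′ → b ≡ b′ → c ≡ c′ → d ≡ d′ →
     (a , b , c , d) ≡ (a′ , b′ , c′ , d′)
≡⁴ refl refl refl refl = refl

entry₁ entry₂ entry₃ entry₄ : ℤ⁴ → ℤ
entry₁ (a , _ , _ , _) = a
entry₂ (_ , b , _ , _) = b
entry₃ (_ , _ , c , _) = c
entry₄ (_ , _ , _ , d) = d

-⁴-involutive : ∀ x → -⁴ -⁴ x ≡ x
-⁴-involutive (a , b , c , d) =
  ≡⁴ (ℤP.neg-involutive a) (ℤP.neg-involutive b) (ℤP.neg-involutive c) (ℤP.neg-involutive d)

module _ where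
  open ℤSolver.+-*-Solver

  x*-y+z*-w : ∀ x y z w → x ℤ.* ℤ.- y ℤ.+ z ℤ.* ℤ.- w ≡ ℤ.- (x ℤ.* y ℤ.+ z ℤ.* w)
  x*-y+z*-w = solve 4 (λ x y z w → x :* (:- y) :+ z :* (:- w) := :- (x :* y :+ z :* w)) refl

  -x*y+-z*w : ∀ x y z w → ℤ.- x ℤ.* y ℤ.+ ℤ.- z ℤ.* w ≡ ℤ.- (x ℤ.* y ℤ.+ z ℤ.* w)
  -x*y+-z*w = solve 4 (λ x y z w → (:- x) :* y :+ (:- z) :* w := :- (x :* y :+ z :* w)) refl

  [xe+yg]i+[xf+yh]k : ∀ x y e f g h i k →
    (x ℤ.* e ℤ.+ y ℤ.* g) ℤ.* i ℤ.+ (x ℤ.* f ℤ.+ y ℤ.* h) ℤ.* k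
      ≡ x ℤ.* (e ℤ.* i ℤ.+ f ℤ.* k) ℤ.+ y ℤ.* (g ℤ.* i ℤ.+ h ℤ.* k)
  [xe+yg]i+[xf+yh]k = solve 8 (λ x y e f g h i k →
    (x :* e :+ y :* g) :* i :+ (x :* f :+ y :* h) :* k
      := x :* (e :* i :+ f :* k) :+ y :* (g :* i :+ h :* k)) refl

  -⁴-distribʳ-∙⁴ : ∀ x y → x ∙⁴ -⁴ y ≡ -⁴ (x ∙⁴ y)
  -⁴-distribʳ-∙⁴ (a , b , c , d) (e , f , g , h) =
    ≡⁴ (x*-y+z*-w a e b g) (x*-y+z*-w a f b h) (x*-y+z*-w c e d g) (x*-y+z*-w c f d h)

  -⁴-distribˡ-∙⁴ : ∀ x y → -⁴ x ∙⁴ y ≡ -⁴ (x ∙⁴ y)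
  -⁴-distribˡ-∙⁴ (a , b , c , d) (e , f , g , h) =
    ≡⁴ (-x*y+-z*w a e b g) (-x*y+-z*w a f b h) (-x*y+-z*w c e d g) (-x*y+-z*w c f d h)

  ∙⁴-assoc : ∀ x y z → (x ∙⁴ y) ∙⁴ z ≡ x ∙⁴ (y ∙⁴ z)
  ∙⁴-assoc (a , b , c , d) (e , f , g , h) (i , j , k , l) =
    ≡⁴ ([xe+yg]i+[xf+yh]k a b e f g h i k) ([xe+yg]i+[xf+yh]k a b e f g h j l)
       ([xe+yg]i+[xf+yh]k c d e f g h i k) ([xe+yg]i+[xf+yh]k c d e f g h j l)

  ∙⁴-identityˡ : ∀ x → entries I₂ ∙⁴ x ≡ x
  ∙⁴-identityˡ (a , b , c , d) = ≡⁴ (1x+0y a c) (1x+0y b d) (0x+1y a c) (0x+1y b d)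
    where
    1x+0y : ∀ x y → + 1 ℤ.* x ℤ.+ + 0 ℤ.* y ≡ x
    1x+0y = solve 2 (λ x y → con (+ 1) :* x :+ con (+ 0) :* y := x) refl
    0x+1y : ∀ x y → + 0 ℤ.* x ℤ.+ + 1 ℤ.* y ≡ y
    0x+1y = solve 2 (λ x y → con (+ 0) :* x :+ con (+ 1) :* y := y) refl

  ∙⁴-identityʳ : ∀ x → x ∙⁴ entries I₂ ≡ x
  ∙⁴-identityʳ (a , b , c , d) = ≡⁴ (x1+y0 a b) (x0+y1 a b) (x1+y0 c d) (x0+y1 c d)
    where
    x1+y0 : ∀ x y → x ℤ.* + 1 ℤ.+ y ℤ.* + 0 ≡ x
    x1+y0 = solve 2 (λ x y → x :* con (+ 1) :+ y :* con (+ 0) := x) refl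
    x0+y1 : ∀ x y → x ℤ.* + 0 ℤ.+ y ℤ.* + 1 ≡ y
    x0+y1 = solve 2 (λ x y → x :* con (+ 0) :+ y :* con (+ 1) := y) refl

  cramer-x : ∀ p q r s x y →
    (p ℤ.* s ℤ.- q ℤ.* r) ℤ.* x ≡ s ℤ.* (p ℤ.* x ℤ.+ q ℤ.* y) ℤ.- q ℤ.* (r ℤ.* x ℤ.+ s ℤ.* y)
  cramer-x = solve 6 (λ p q r s x y →
    (p :* s :- q :* r) :* x := s :* (p :* x :+ q :* y) :- q :* (r :* x :+ s :* y)) refl

  cramer-y : ∀ p q r s x y →
    (p ℤ.* s ℤ.- q ℤ.* r) ℤ.* y ≡ p ℤ.* (r ℤ.* x ℤ.+ s ℤ.* y) ℤ.- r ℤ.* (p ℤ.* x ℤ.+ q ℤ.* y)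
  cramer-y = solve 6 (λ p q r s x y →
    (p :* s :- q :* r) :* y := p :* (r :* x :+ s :* y) :- r :* (p :* x :+ q :* y)) refl

  cramerᵀ-x : ∀ p q r s x y →
    (p ℤ.* s ℤ.- q ℤ.* r) ℤ.* x ≡ s ℤ.* (x ℤ.* p ℤ.+ y ℤ.* r) ℤ.- r ℤ.* (x ℤ.* q ℤ.+ y ℤ.* s)
  cramerᵀ-x = solve 6 (λ p q r s x y →
    (p :* s :- q :* r) :* x := s :* (x :* p :+ y :* r) :- r :* (x :* q :+ y :* s)) refl

  cramerᵀ-y : ∀ p q r s x y →
    (p ℤ.* s ℤ.- q ℤ.* r) ℤ.* y ≡ p ℤ.* (x ℤ.* q ℤ.+ y ℤ.* s) ℤ.- q ℤ.* (x ℤ.* p ℤ.+ y ℤ.* r)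
  cramerᵀ-y = solve 6 (λ p q r s x y →
    (p :* s :- q :* r) :* y := p :* (x :* q :+ y :* s) :- q :* (x :* p :+ y :* r)) refl

detᴹ : Mat → ℤ
detᴹ m = det (Mat.a m) (Mat.b m) (Mat.c m) (Mat.d m)

det-cancel : ∀ m {x y} → detᴹ m ℤ.* x ≡ detᴹ m ℤ.* y → x ≡ y
det-cancel m = ℤP.*-cancelˡ-≡ (detᴹ m) _ _ {{ℤ.>-nonZero (Mat.detPos m)}}

-- Cramer's rule: each column of t is determined by the corresponding column of s · t.
∙⁴-cancelˡ : ∀ s {y z} → entries s ∙⁴ y ≡ entries s ∙⁴ z → y ≡ z
∙⁴-cancelˡ s@(mat p q r t _) {y₁ , y₂ , y₃ , y₄} {z₁ , z₂ , z₃ , z₄} eq =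
  ≡⁴ (column-x (cong entry₁ eq) (cong entry₃ eq)) (column-x (cong entry₂ eq) (cong entry₄ eq))
     (column-y (cong entry₁ eq) (cong entry₃ eq)) (column-y (cong entry₂ eq) (cong entry₄ eq))
  where
  column-x : ∀ {x y x′ y′} → p ℤ.* x ℤ.+ q ℤ.* y ≡ p ℤ.* x′ ℤ.+ q ℤ.* y′ →
             r ℤ.* x ℤ.+ t ℤ.* y ≡ r ℤ.* x′ ℤ.+ t ℤ.* y′ → x ≡ x′
  column-x {x} {y} {x′} {y′} e₁ e₂ = det-cancel s (trans (cramer-x p q r t x y)
    (trans (cong₂ (λ u v → t ℤ.* u ℤ.- q ℤ.* v) e₁ e₂) (sym (cramer-x p q r t x′ y′))))
  column-y : ∀ {x y x′ y′} → p ℤ.* x ℤ.+ q ℤ.* y ≡ p ℤ.* x′ ℤ.+ q ℤ.* y′ →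
             r ℤ.* x ℤ.+ t ℤ.* y ≡ r ℤ.* x′ ℤ.+ t ℤ.* y′ → y ≡ y′
  column-y {x} {y} {x′} {y′} e₁ e₂ = det-cancel s (trans (cramer-y p q r t x y)
    (trans (cong₂ (λ u v → p ℤ.* u ℤ.- r ℤ.* v) e₂ e₁) (sym (cramer-y p q r t x′ y′))))

∙⁴-cancelʳ : ∀ t {y z} → y ∙⁴ entries t ≡ z ∙⁴ entries t → y ≡ z
∙⁴-cancelʳ t@(mat p q r s _) {y₁ , y₂ , y₃ , y₄} {z₁ , z₂ , z₃ , z₄} eq =
  ≡⁴ (row-x y₁ y₂ z₁ z₂ (cong entry₁ eq) (cong entry₂ eq))
     (row-y y₁ y₂ z₁ z₂ (cong entry₁ eq) (cong entry₂ eq))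
     (row-x y₃ y₄ z₃ z₄ (cong entry₃ eq) (cong entry₄ eq))
     (row-y y₃ y₄ z₃ z₄ (cong entry₃ eq) (cong entry₄ eq))
  where
  row-x : ∀ x y x′ y′ → x ℤ.* p ℤ.+ y ℤ.* r ≡ x′ ℤ.* p ℤ.+ y′ ℤ.* r →
          x ℤ.* q ℤ.+ y ℤ.* s ≡ x′ ℤ.* q ℤ.+ y′ ℤ.* s → x ≡ x′
  row-x x y x′ y′ e₁ e₂ = det-cancel t (trans (cramerᵀ-x p q r s x y)
    (trans (cong₂ (λ u v → s ℤ.* u ℤ.- r ℤ.* v) e₁ e₂) (sym (cramerᵀ-x p q r s x′ y′))))
  row-y : ∀ x y x′ y′ → x ℤ.* p ℤ.+ y ℤ.* r ≡ x′ ℤ.* p ℤ.+ y′ ℤ.* r →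
          x ℤ.* q ℤ.+ y ℤ.* s ≡ x′ ℤ.* q ℤ.+ y′ ℤ.* s → y ≡ y′
  row-y x y x′ y′ e₁ e₂ = det-cancel t (trans (cramerᵀ-y p q r s x y)
    (trans (cong₂ (λ u v → p ℤ.* u ℤ.- q ℤ.* v) e₂ e₁) (sym (cramerᵀ-y p q r s x′ y′))))

∼-refl : ∀ {n} → n ∼ n
∼-refl = same refl

∼-sym : ∀ {n m} → n ∼ m → m ∼ n
∼-sym (same eq) = same (sym eq)
∼-sym {m = m} (opposite eq) = opposite (trans (sym (-⁴-involutive (entries m))) (cong -⁴_ (sym eq)))

∼-trans : ∀ {n m k} → n ∼ m → m ∼ k → n ∼ k
∼-trans (same eq) (same eq′) = same (trans eq eq′)
∼-trans (same eq) (opposite eq′) = opposite (trans eq eq′)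
∼-trans (opposite eq) (same eq′) = opposite (trans eq (cong -⁴_ eq′))
∼-trans {k = k} (opposite eq) (opposite eq′) =
  same (trans eq (trans (cong -⁴_ eq′) (-⁴-involutive (entries k))))

·-congˡ : ∀ s {t t′} → t ∼ t′ → s · t ∼ s · t′
·-congˡ s (same eq) = same (cong (entries s ∙⁴_) eq)
·-congˡ s {t′ = t′} (opposite eq) =
  opposite (trans (cong (entries s ∙⁴_) eq) (-⁴-distribʳ-∙⁴ (entries s) (entries t′)))

·-congʳ : ∀ t {s s′} → s ∼ s′ → s · t ∼ s′ · t
·-congʳ t (same eq) = same (cong (_∙⁴ entries t) eq)
·-congʳ t {s′ = s′} (opposite eq) =
  opposite (trans (cong (_∙⁴ entries t) eq) (-⁴-distribˡ-∙⁴ (entries s′) (entries t)))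

·-cancelˡ : ∀ s {t t′} → s · t ∼ s · t′ → t ∼ t′
·-cancelˡ s (same eq) = same (∙⁴-cancelˡ s eq)
·-cancelˡ s {t′ = t′} (opposite eq) =
  opposite (∙⁴-cancelˡ s (trans eq (sym (-⁴-distribʳ-∙⁴ (entries s) (entries t′)))))

·-cancelʳ : ∀ t {s s′} → s · t ∼ s′ · t → s ∼ s′
·-cancelʳ t (same eq) = same (∙⁴-cancelʳ t eq)
·-cancelʳ t {s′ = s′} (opposite eq) =
  opposite (∙⁴-cancelʳ t (trans eq (sym (-⁴-distribˡ-∙⁴ (entries s′) (entries t)))))

·-assoc : ∀ s t u → (s · t) · u ∼ s · (t · u)
·-assoc s t u = same (∙⁴-assoc (entries s) (entries t) (entries u))

·-identityˡ : ∀ t → I₂ · t ∼ t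
·-identityˡ t = same (∙⁴-identityˡ (entries t))

·-identityʳ : ∀ t → t · I₂ ∼ t
·-identityʳ t = same (∙⁴-identityʳ (entries t))

T-=ℤ⁴ : ∀ {a b c d a′ b′ c′ d′} →
  T (a =ℤ a′ ∧ b =ℤ b′ ∧ c =ℤ c′ ∧ d =ℤ d′) ⇔ (a , b , c , d) ≡ (a′ , b′ , c′ , d′)
T-=ℤ⁴ {a} {b} {c} {d} {a′} {b′} {c′} {d′} = mk⇔ to from
  where
  to : T (a =ℤ a′ ∧ b =ℤ b′ ∧ c =ℤ c′ ∧ d =ℤ d′) → (a , b , c , d) ≡ (a′ , b′ , c′ , d′)
  to t with Equivalence.to (T-∧ {a =ℤ a′}) t
  ... | ta , t′ with Equivalence.to (T-∧ {b =ℤ b′}) t′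
  ...   | tb , t″ with Equivalence.to (T-∧ {c =ℤ c′}) t″
  ...     | tc , td = ≡⁴ (toWitness ta) (toWitness tb) (toWitness tc) (toWitness td)
  from : (a , b , c , d) ≡ (a′ , b′ , c′ , d′) → T (a =ℤ a′ ∧ b =ℤ b′ ∧ c =ℤ c′ ∧ d =ℤ d′)
  from eq = Equivalence.from (T-∧ {a =ℤ a′}) (fromWitness (cong entry₁ eq) ,
            Equivalence.from (T-∧ {b =ℤ b′}) (fromWitness (cong entry₂ eq) ,
            Equivalence.from (T-∧ {c =ℤ c′}) (fromWitness (cong entry₃ eq) ,
                                              fromWitness (cong entry₄ eq))))

sameM⇔∼ : ∀ n m → sameM n m ≡ true ⇔ n ∼ m
sameM⇔∼ n@(mat a b c d _) m@(mat a′ b′ c′ d′ _) = mk⇔ to from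
  where
  equal negated : Bool
  equal   = a =ℤ a′ ∧ b =ℤ b′ ∧ c =ℤ c′ ∧ d =ℤ d′
  negated = a =ℤ ℤ.- a′ ∧ b =ℤ ℤ.- b′ ∧ c =ℤ ℤ.- c′ ∧ d =ℤ ℤ.- d′
  to : sameM n m ≡ true → n ∼ m
  to e with Equivalence.to (T-∨ {equal} {negated}) (Equivalence.from T-≡ e)
  ... | inj₁ t = same (Equivalence.to T-=ℤ⁴ t)
  ... | inj₂ t = opposite (Equivalence.to T-=ℤ⁴ t)
  from : n ∼ m → sameM n m ≡ true
  from (same eq)     =
    Equivalence.to T-≡ (Equivalence.from (T-∨ {equal}) (inj₁ (Equivalence.from T-=ℤ⁴ eq)))
  from (opposite eq) =
    Equivalence.to T-≡ (Equivalence.from (T-∨ {equal}) (inj₂ (Equivalence.from T-=ℤ⁴ eq)))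

sameM-≡ : ∀ n m n′ m′ → (n ∼ m → n′ ∼ m′) → (n′ ∼ m′ → n ∼ m) → sameM n m ≡ sameM n′ m′
sameM-≡ n m n′ m′ f g = ⇔→≡ (mk⇔
  (λ e → Equivalence.from (sameM⇔∼ n′ m′) (f (Equivalence.to (sameM⇔∼ n m) e)))
  (λ e → Equivalence.from (sameM⇔∼ n m) (g (Equivalence.to (sameM⇔∼ n′ m′) e))))

sameM-resp : ∀ {n n′ m m′} → n ∼ n′ → m ∼ m′ → sameM n m ≡ sameM n′ m′
sameM-resp {n} {n′} {m} {m′} n∼n′ m∼m′ = sameM-≡ n m n′ m′
  (λ n∼m → ∼-trans (∼-sym n∼n′) (∼-trans n∼m m∼m′))
  (λ n′∼m′ → ∼-trans n∼n′ (∼-trans n′∼m′ (∼-sym m∼m′)))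

sameM-cancelˡ : ∀ s t t′ → sameM (s · t) (s · t′) ≡ sameM t t′
sameM-cancelˡ s t t′ = sameM-≡ (s · t) (s · t′) t t′ (·-cancelˡ s) (·-congˡ s)

sameM-cancelʳ : ∀ t s s′ → sameM (s · t) (s′ · t) ≡ sameM s s′
sameM-cancelʳ t s s′ = sameM-≡ (s · t) (s′ · t) s s′ (·-cancelʳ t) (·-congʳ t)

-- 𝓡 is a ring

infix 0 ⟪_,_⟫

⟪_,_⟫ : R → (Mat → ℚ) → ℚ
⟪ [] , H ⟫          = 0ℚ
⟪ (q , n) ∷ ξ , H ⟫ = q ℚ.* H n ℚ.+ ⟪ ξ , H ⟫

𝟙 : Bool → ℚ
𝟙 b = if b then 1ℚ else 0ℚ

δ : Mat → Mat → ℚ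
δ m n = 𝟙 (sameM n m)

module _ where
  open ℚSolver.+-*-Solver

  p*[q*x]+q*y≡q*[p*x+y] : ∀ p q x y → p ℚ.* (q ℚ.* x) ℚ.+ q ℚ.* y ≡ q ℚ.* (p ℚ.* x ℚ.+ y)
  p*[q*x]+q*y≡q*[p*x+y] = solve 4 (λ p q x y → p :* (q :* x) :+ q :* y := q :* (p :* x :+ y)) refl

  [q*p]*x+q*y≡q*[p*x+y] : ∀ p q x y → (q ℚ.* p) ℚ.* x ℚ.+ q ℚ.* y ≡ q ℚ.* (p ℚ.* x ℚ.+ y)
  [q*p]*x+q*y≡q*[p*x+y] = solve 4 (λ p q x y → (q :* p) :* x :+ q :* y := q :* (p :* x :+ y)) refl

  q*[x+y]+[a+b]≡[q*x+a]+[q*y+b] : ∀ q x y a b →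
    q ℚ.* (x ℚ.+ y) ℚ.+ (a ℚ.+ b) ≡ (q ℚ.* x ℚ.+ a) ℚ.+ (q ℚ.* y ℚ.+ b)
  q*[x+y]+[a+b]≡[q*x+a]+[q*y+b] = solve 5 (λ q x y a b →
    q :* (x :+ y) :+ (a :+ b) := (q :* x :+ a) :+ (q :* y :+ b)) refl

  1*x+0≡x : ∀ x → 1ℚ ℚ.* x ℚ.+ 0ℚ ≡ x
  1*x+0≡x = solve 1 (λ x → con 1ℚ :* x :+ con 0ℚ := x) refl

coeff≡⟪δ⟫ : ∀ ξ m → coeff ξ m ≡ ⟪ ξ , δ m ⟫
coeff≡⟪δ⟫ [] m = refl
coeff≡⟪δ⟫ ((q , n) ∷ ξ) m = cong₂ ℚ._+_ (if≡*𝟙 (sameM n m)) (coeff≡⟪δ⟫ ξ m)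
  where
  if≡*𝟙 : ∀ b → (if b then q else 0ℚ) ≡ q ℚ.* 𝟙 b
  if≡*𝟙 true  = sym (ℚP.*-identityʳ q)
  if≡*𝟙 false = sym (ℚP.*-zeroʳ q)

⟪⟫-cong : ∀ ξ {H G} → (∀ n → H n ≡ G n) → ⟪ ξ , H ⟫ ≡ ⟪ ξ , G ⟫
⟪⟫-cong [] H≗G = refl
⟪⟫-cong ((q , n) ∷ ξ) H≗G = cong₂ (λ x y → q ℚ.* x ℚ.+ y) (H≗G n) (⟪⟫-cong ξ H≗G)

⟪⟫-++ : ∀ ξ η H → ⟪ ξ ++ η , H ⟫ ≡ ⟪ ξ , H ⟫ ℚ.+ ⟪ η , H ⟫
⟪⟫-++ [] η H = sym (ℚP.+-identityˡ _)
⟪⟫-++ ((q , n) ∷ ξ) η H =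
  trans (cong (q ℚ.* H n ℚ.+_) (⟪⟫-++ ξ η H)) (sym (ℚP.+-assoc (q ℚ.* H n) _ _))

⟪⟫-*ˡ : ∀ ξ q H → ⟪ ξ , (λ n → q ℚ.* H n) ⟫ ≡ q ℚ.* ⟪ ξ , H ⟫
⟪⟫-*ˡ [] q H = sym (ℚP.*-zeroʳ q)
⟪⟫-*ˡ ((p , n) ∷ ξ) q H =
  trans (cong (p ℚ.* (q ℚ.* H n) ℚ.+_) (⟪⟫-*ˡ ξ q H)) (p*[q*x]+q*y≡q*[p*x+y] p q (H n) ⟪ ξ , H ⟫)

⟪⟫-+ : ∀ ξ H G → ⟪ ξ , (λ n → H n ℚ.+ G n) ⟫ ≡ ⟪ ξ , H ⟫ ℚ.+ ⟪ ξ , G ⟫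
⟪⟫-+ [] H G = sym (ℚP.+-identityˡ 0ℚ)
⟪⟫-+ ((q , n) ∷ ξ) H G = trans (cong (q ℚ.* (H n ℚ.+ G n) ℚ.+_) (⟪⟫-+ ξ H G))
  (q*[x+y]+[a+b]≡[q*x+a]+[q*y+b] q (H n) (G n) ⟪ ξ , H ⟫ ⟪ ξ , G ⟫)

⟪⟫-0 : ∀ ξ → ⟪ ξ , (λ _ → 0ℚ) ⟫ ≡ 0ℚ
⟪⟫-0 ξ = trans (⟪⟫-*ˡ ξ 0ℚ (λ _ → 0ℚ)) (ℚP.*-zeroˡ ⟪ ξ , (λ _ → 0ℚ) ⟫)

⟪⟫-comm : ∀ ξ η (F : Mat → Mat → ℚ) →
          ⟪ ξ , (λ s → ⟪ η , F s ⟫) ⟫ ≡ ⟪ η , (λ t → ⟪ ξ , (λ s → F s t) ⟫) ⟫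
⟪⟫-comm [] η F = sym (⟪⟫-0 η)
⟪⟫-comm ((q , s) ∷ ξ) η F = begin
  q ℚ.* ⟪ η , F s ⟫ ℚ.+ ⟪ ξ , (λ s′ → ⟪ η , F s′ ⟫) ⟫
    ≡⟨ cong₂ ℚ._+_ (sym (⟪⟫-*ˡ η q (F s))) (⟪⟫-comm ξ η F) ⟩
  ⟪ η , (λ t → q ℚ.* F s t) ⟫ ℚ.+ ⟪ η , (λ t → ⟪ ξ , (λ s′ → F s′ t) ⟫) ⟫
    ≡⟨ ⟪⟫-+ η _ _ ⟨
  ⟪ η , (λ t → q ℚ.* F s t ℚ.+ ⟪ ξ , (λ s′ → F s′ t) ⟫) ⟫ ∎
  where open ≡-Reasoning

⟪⟫-map : ∀ q (g : Mat → Mat) η H →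
         ⟪ Data.List.map (λ t → (q ℚ.* proj₁ t , g (proj₂ t))) η , H ⟫ ≡ q ℚ.* ⟪ η , H ∘ g ⟫
⟪⟫-map q g [] H = sym (ℚP.*-zeroʳ q)
⟪⟫-map q g ((p , t) ∷ η) H =
  trans (cong ((q ℚ.* p) ℚ.* H (g t) ℚ.+_) (⟪⟫-map q g η H)) ([q*p]*x+q*y≡q*[p*x+y] p q (H (g t)) _)

⟪⟫-scale : ∀ q ξ H → ⟪ scale q ξ , H ⟫ ≡ q ℚ.* ⟪ ξ , H ⟫
⟪⟫-scale q = ⟪⟫-map q (λ n → n)

⟪⟫-⊛ : ∀ ξ η H → ⟪ ξ ⊛ η , H ⟫ ≡ ⟪ ξ , (λ s → ⟪ η , H ∘ (s ·_) ⟫) ⟫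
⟪⟫-⊛ [] η H = refl
⟪⟫-⊛ ((q , s) ∷ ξ) η H =
  trans (⟪⟫-++ (Data.List.map (λ t → (q ℚ.* proj₁ t , s · proj₂ t)) η) (ξ ⊛ η) H)
        (cong₂ ℚ._+_ (⟪⟫-map q (s ·_) η H) (⟪⟫-⊛ ξ η H))

⟪ι⟫ : ∀ n H → ⟪ ι n , H ⟫ ≡ H n
⟪ι⟫ n H = 1*x+0≡x (H n)

IsClassIndicator : (Mat → Bool) → Set
IsClassIndicator P = ∀ n₀ → P n₀ ≡ true → ∀ n → P n ≡ sameM n n₀

find : ∀ P ξ → (∃[ n ] P n ≡ true) ⊎ ⟪ ξ , 𝟙 ∘ P ⟫ ≡ 0ℚ
find P [] = inj₂ refl
find P ((q , n) ∷ ξ) with P n in Pn≡true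
... | true = inj₁ (n , Pn≡true)
... | false with find P ξ
...   | inj₁ found = inj₁ found
...   | inj₂ sum≡0 = inj₂ (trans (cong (q ℚ.* 0ℚ ℚ.+_) sum≡0) (q*0+0≡0 q))
  where
  q*0+0≡0 : ∀ q → q ℚ.* 0ℚ ℚ.+ 0ℚ ≡ 0ℚ
  q*0+0≡0 q = trans (ℚP.+-identityʳ _) (ℚP.*-zeroʳ q)

class-sum≡coeff : ∀ {P n₀} → IsClassIndicator P → P n₀ ≡ true → ∀ ξ → ⟪ ξ , 𝟙 ∘ P ⟫ ≡ coeff ξ n₀
class-sum≡coeff {n₀ = n₀} isClass Pn₀ ξ =
  trans (⟪⟫-cong ξ (cong 𝟙 ∘ isClass n₀ Pn₀)) (sym (coeff≡⟪δ⟫ ξ n₀))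

-- A sum over one ∼-class is a coefficient, or zero when no term lies in the class.
class-sum-resp-≈ : ∀ {P} → IsClassIndicator P →
                   ∀ ξ ξ′ → ξ ≈ ξ′ → ⟪ ξ , 𝟙 ∘ P ⟫ ≡ ⟪ ξ′ , 𝟙 ∘ P ⟫
class-sum-resp-≈ {P} isClass ξ ξ′ ξ≈ξ′ with find P ξ | find P ξ′
... | inj₁ (n₀ , Pn₀) | _ = trans (class-sum≡coeff isClass Pn₀ ξ)
                              (trans (ξ≈ξ′ n₀) (sym (class-sum≡coeff isClass Pn₀ ξ′)))
... | inj₂ _ | inj₁ (n₀ , Pn₀) = trans (class-sum≡coeff isClass Pn₀ ξ)
                                   (trans (ξ≈ξ′ n₀) (sym (class-sum≡coeff isClass Pn₀ ξ′)))
... | inj₂ sum≡0 | inj₂ sum′≡0 = trans sum≡0 (sym sum′≡0)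

left-class : ∀ s m → IsClassIndicator (λ t → sameM (s · t) m)
left-class s m t₀ st₀∼m t =
  trans (sameM-resp (∼-refl {s · t}) (∼-sym (Equivalence.to (sameM⇔∼ (s · t₀) m) st₀∼m)))
        (sameM-cancelˡ s t t₀)

right-class : ∀ t m → IsClassIndicator (λ s → sameM (s · t) m)
right-class t m s₀ s₀t∼m s =
  trans (sameM-resp (∼-refl {s · t}) (∼-sym (Equivalence.to (sameM⇔∼ (s₀ · t) m) s₀t∼m)))
        (sameM-cancelʳ t s s₀)

δ-resp : ∀ m {n n′} → n ∼ n′ → δ m n ≡ δ m n′
δ-resp m n∼n′ = cong 𝟙 (sameM-resp n∼n′ (∼-refl {m}))

coeff-⊕ : ∀ ξ η m → coeff (ξ ⊕ η) m ≡ coeff ξ m ℚ.+ coeff η m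
coeff-⊕ ξ η m = trans (coeff≡⟪δ⟫ (ξ ⊕ η) m)
  (trans (⟪⟫-++ ξ η (δ m)) (sym (cong₂ ℚ._+_ (coeff≡⟪δ⟫ ξ m) (coeff≡⟪δ⟫ η m))))

coeff-scale : ∀ q ξ m → coeff (scale q ξ) m ≡ q ℚ.* coeff ξ m
coeff-scale q ξ m = trans (coeff≡⟪δ⟫ (scale q ξ) m)
  (trans (⟪⟫-scale q ξ (δ m)) (sym (cong (q ℚ.*_) (coeff≡⟪δ⟫ ξ m))))

coeff-⊛ : ∀ ξ η m → coeff (ξ ⊛ η) m ≡ ⟪ ξ , (λ s → ⟪ η , δ m ∘ (s ·_) ⟫) ⟫
coeff-⊛ ξ η m = trans (coeff≡⟪δ⟫ (ξ ⊛ η) m) (⟪⟫-⊛ ξ η (δ m))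

coeff-⊛′ : ∀ ξ η m → coeff (ξ ⊛ η) m ≡ ⟪ η , (λ t → ⟪ ξ , (λ s → δ m (s · t)) ⟫) ⟫
coeff-⊛′ ξ η m = trans (coeff-⊛ ξ η m) (⟪⟫-comm ξ η (λ s t → δ m (s · t)))

module _ where
  open ℚSolver.+-*-Solver

  x+-1*x≡0 : ∀ x → x ℚ.+ ℚ.- 1ℚ ℚ.* x ≡ 0ℚ
  x+-1*x≡0 = solve 1 (λ x → x :+ con (ℚ.- 1ℚ) :* x := con 0ℚ) refl

  -1*x+x≡0 : ∀ x → ℚ.- 1ℚ ℚ.* x ℚ.+ x ≡ 0ℚ
  -1*x+x≡0 = solve 1 (λ x → con (ℚ.- 1ℚ) :* x :+ x := con 0ℚ) refl

-- _≈_ is a function type, so the endpoints of an ≈-proof are never inferred and are given explicitly.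
⊛-congˡ : ∀ ξ {η η′} → η ≈ η′ → ξ ⊛ η ≈ ξ ⊛ η′
⊛-congˡ ξ {η} {η′} η≈η′ m = begin
  coeff (ξ ⊛ η) m                              ≡⟨ coeff-⊛ ξ η m ⟩
  ⟪ ξ , (λ s → ⟪ η , δ m ∘ (s ·_) ⟫) ⟫
    ≡⟨ ⟪⟫-cong ξ (λ s → class-sum-resp-≈ (left-class s m) η η′ η≈η′) ⟩
  ⟪ ξ , (λ s → ⟪ η′ , δ m ∘ (s ·_) ⟫) ⟫         ≡⟨ coeff-⊛ ξ η′ m ⟨
  coeff (ξ ⊛ η′) m                             ∎
  where open ≡-Reasoning

⊛-congʳ : ∀ η {ξ ξ′} → ξ ≈ ξ′ → ξ ⊛ η ≈ ξ′ ⊛ η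
⊛-congʳ η {ξ} {ξ′} ξ≈ξ′ m = begin
  coeff (ξ ⊛ η) m                                 ≡⟨ coeff-⊛′ ξ η m ⟩
  ⟪ η , (λ t → ⟪ ξ , (λ s → δ m (s · t)) ⟫) ⟫
    ≡⟨ ⟪⟫-cong η (λ t → class-sum-resp-≈ (right-class t m) ξ ξ′ ξ≈ξ′) ⟩
  ⟪ η , (λ t → ⟪ ξ′ , (λ s → δ m (s · t)) ⟫) ⟫     ≡⟨ coeff-⊛′ ξ′ η m ⟨
  coeff (ξ′ ⊛ η) m                                ∎
  where open ≡-Reasoning

⊛-assoc : ∀ ξ η ζ → (ξ ⊛ η) ⊛ ζ ≈ ξ ⊛ (η ⊛ ζ)
⊛-assoc ξ η ζ m = begin
  coeff ((ξ ⊛ η) ⊛ ζ) m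
    ≡⟨ coeff-⊛ (ξ ⊛ η) ζ m ⟩
  ⟪ ξ ⊛ η , (λ v → ⟪ ζ , δ m ∘ (v ·_) ⟫) ⟫
    ≡⟨ ⟪⟫-⊛ ξ η (λ v → ⟪ ζ , δ m ∘ (v ·_) ⟫) ⟩
  ⟪ ξ , (λ s → ⟪ η , (λ t → ⟪ ζ , δ m ∘ ((s · t) ·_) ⟫) ⟫) ⟫
    ≡⟨ ⟪⟫-cong ξ (λ s → ⟪⟫-cong η (λ t → ⟪⟫-cong ζ (λ u → δ-resp m (·-assoc s t u)))) ⟩
  ⟪ ξ , (λ s → ⟪ η , (λ t → ⟪ ζ , δ m ∘ ((s ·_) ∘ (t ·_)) ⟫) ⟫) ⟫
    ≡⟨ ⟪⟫-cong ξ (λ s → ⟪⟫-⊛ η ζ (δ m ∘ (s ·_))) ⟨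
  ⟪ ξ , (λ s → ⟪ η ⊛ ζ , δ m ∘ (s ·_) ⟫) ⟫
    ≡⟨ coeff-⊛ ξ (η ⊛ ζ) m ⟨
  coeff (ξ ⊛ (η ⊛ ζ)) m ∎
  where open ≡-Reasoning

⊛-identityˡ : ∀ ξ → 1R ⊛ ξ ≈ ξ
⊛-identityˡ ξ m = begin
  coeff (1R ⊛ ξ) m                    ≡⟨ coeff-⊛ 1R ξ m ⟩
  ⟪ 1R , (λ s → ⟪ ξ , δ m ∘ (s ·_) ⟫) ⟫ ≡⟨ ⟪ι⟫ I₂ (λ s → ⟪ ξ , δ m ∘ (s ·_) ⟫) ⟩
  ⟪ ξ , δ m ∘ (I₂ ·_) ⟫                ≡⟨ ⟪⟫-cong ξ (λ t → δ-resp m (·-identityˡ t)) ⟩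
  ⟪ ξ , δ m ⟫                          ≡⟨ coeff≡⟪δ⟫ ξ m ⟨
  coeff ξ m                            ∎
  where open ≡-Reasoning

⊛-identityʳ : ∀ ξ → ξ ⊛ 1R ≈ ξ
⊛-identityʳ ξ m = begin
  coeff (ξ ⊛ 1R) m                              ≡⟨ coeff-⊛′ ξ 1R m ⟩
  ⟪ 1R , (λ t → ⟪ ξ , (λ s → δ m (s · t)) ⟫) ⟫    ≡⟨ ⟪ι⟫ I₂ (λ t → ⟪ ξ , (λ s → δ m (s · t)) ⟫) ⟩
  ⟪ ξ , (λ s → δ m (s · I₂)) ⟫                   ≡⟨ ⟪⟫-cong ξ (λ s → δ-resp m (·-identityʳ s)) ⟩
  ⟪ ξ , δ m ⟫                                    ≡⟨ coeff≡⟪δ⟫ ξ m ⟨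
  coeff ξ m                                      ∎
  where open ≡-Reasoning

⊛-distribˡ : ∀ ξ η ζ → ξ ⊛ (η ⊕ ζ) ≈ ξ ⊛ η ⊕ ξ ⊛ ζ
⊛-distribˡ ξ η ζ m = begin
  coeff (ξ ⊛ (η ⊕ ζ)) m
    ≡⟨ coeff-⊛ ξ (η ⊕ ζ) m ⟩
  ⟪ ξ , (λ s → ⟪ η ⊕ ζ , δ m ∘ (s ·_) ⟫) ⟫
    ≡⟨ ⟪⟫-cong ξ (λ s → ⟪⟫-++ η ζ (δ m ∘ (s ·_))) ⟩
  ⟪ ξ , (λ s → ⟪ η , δ m ∘ (s ·_) ⟫ ℚ.+ ⟪ ζ , δ m ∘ (s ·_) ⟫) ⟫
    ≡⟨ ⟪⟫-+ ξ (λ s → ⟪ η , δ m ∘ (s ·_) ⟫) (λ s → ⟪ ζ , δ m ∘ (s ·_) ⟫) ⟩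
  ⟪ ξ , (λ s → ⟪ η , δ m ∘ (s ·_) ⟫) ⟫ ℚ.+ ⟪ ξ , (λ s → ⟪ ζ , δ m ∘ (s ·_) ⟫) ⟫
    ≡⟨ cong₂ ℚ._+_ (coeff-⊛ ξ η m) (coeff-⊛ ξ ζ m) ⟨
  coeff (ξ ⊛ η) m ℚ.+ coeff (ξ ⊛ ζ) m
    ≡⟨ coeff-⊕ (ξ ⊛ η) (ξ ⊛ ζ) m ⟨
  coeff (ξ ⊛ η ⊕ ξ ⊛ ζ) m ∎
  where open ≡-Reasoning

⊛-distribʳ : ∀ ξ η ζ → (η ⊕ ζ) ⊛ ξ ≈ η ⊛ ξ ⊕ ζ ⊛ ξ
⊛-distribʳ ξ η ζ m = begin
  coeff ((η ⊕ ζ) ⊛ ξ) m                ≡⟨ coeff-⊛ (η ⊕ ζ) ξ m ⟩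
  ⟪ η ⊕ ζ , (λ s → ⟪ ξ , δ m ∘ (s ·_) ⟫) ⟫ ≡⟨ ⟪⟫-++ η ζ (λ s → ⟪ ξ , δ m ∘ (s ·_) ⟫) ⟩
  ⟪ η , (λ s → ⟪ ξ , δ m ∘ (s ·_) ⟫) ⟫ ℚ.+ ⟪ ζ , (λ s → ⟪ ξ , δ m ∘ (s ·_) ⟫) ⟫
    ≡⟨ cong₂ ℚ._+_ (coeff-⊛ η ξ m) (coeff-⊛ ζ ξ m) ⟨
  coeff (η ⊛ ξ) m ℚ.+ coeff (ζ ⊛ ξ) m  ≡⟨ coeff-⊕ (η ⊛ ξ) (ζ ⊛ ξ) m ⟨
  coeff (η ⊛ ξ ⊕ ζ ⊛ ξ) m              ∎
  where open ≡-Reasoning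

𝓡-isRing : IsRing _≈_ _⊕_ _⊛_ ⊖_ 0R 1R
𝓡-isRing = record
  { +-isAbelianGroup = record
    { isGroup = record
      { isMonoid = record
        { isSemigroup = record
          { isMagma = record
            { isEquivalence = record
              { refl  = λ m → refl
              ; sym   = λ ξ≈η m → sym (ξ≈η m)
              ; trans = λ ξ≈η η≈ζ m → trans (ξ≈η m) (η≈ζ m)
              }
            ; ∙-cong = λ {ξ} {ξ′} {η} {η′} ξ≈ξ′ η≈η′ m →
                trans (coeff-⊕ ξ η m) (trans (cong₂ ℚ._+_ (ξ≈ξ′ m) (η≈η′ m)) (sym (coeff-⊕ ξ′ η′ m)))
            }
          ; assoc = λ ξ η ζ m → cong (λ ρ → coeff ρ m) (++-assoc ξ η ζ)
          }
        ; identity = (λ ξ m → refl) , (λ ξ m → cong (λ ρ → coeff ρ m) (++-identityʳ ξ))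
        }
      ; inverse = (λ ξ m → trans (coeff-⊕ (⊖ ξ) ξ m)
                     (trans (cong (ℚ._+ coeff ξ m) (coeff-scale (ℚ.- 1ℚ) ξ m)) (-1*x+x≡0 (coeff ξ m))))
                , (λ ξ m → trans (coeff-⊕ ξ (⊖ ξ) m)
                     (trans (cong (coeff ξ m ℚ.+_) (coeff-scale (ℚ.- 1ℚ) ξ m)) (x+-1*x≡0 (coeff ξ m))))
      ; ⁻¹-cong = λ {ξ} {η} ξ≈η m → trans (coeff-scale (ℚ.- 1ℚ) ξ m)
          (trans (cong (ℚ.- 1ℚ ℚ.*_) (ξ≈η m)) (sym (coeff-scale (ℚ.- 1ℚ) η m)))
      }
    ; comm = λ ξ η m →
        trans (coeff-⊕ ξ η m) (trans (ℚP.+-comm (coeff ξ m) (coeff η m)) (sym (coeff-⊕ η ξ m)))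
    }
  ; *-cong = λ {ξ} {ξ′} {η} {η′} ξ≈ξ′ η≈η′ m →
      trans (⊛-congʳ η {ξ} {ξ′} ξ≈ξ′ m) (⊛-congˡ ξ′ {η} {η′} η≈η′ m)
  ; *-assoc = ⊛-assoc
  ; *-identity = ⊛-identityˡ , ⊛-identityʳ
  ; distrib = ⊛-distribˡ , ⊛-distribʳ
  }

𝓡-ring : Ring 0ℓ 0ℓ
𝓡-ring = record { isRing = 𝓡-isRing }

-- The idempotents πS and πU

½ ⅓ : ℚ
½ = + 1 ℚ./ 2
⅓ = + 1 ℚ./ 3

Respects∼ : (Mat → ℚ) → Set
Respects∼ H = ∀ {n n′} → n ∼ n′ → H n ≡ H n′

module _ where
  open ℚSolver.+-*-Solver

  ⟪πS⟫ : ∀ H → ⟪ πS , H ⟫ ≡ ½ ℚ.* (H I₂ ℚ.+ H S)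
  ⟪πS⟫ H = expand (H I₂) (H S)
    where
    expand : ∀ x y → ½ ℚ.* 1ℚ ℚ.* x ℚ.+ (½ ℚ.* 1ℚ ℚ.* y ℚ.+ 0ℚ) ≡ ½ ℚ.* (x ℚ.+ y)
    expand = solve 2 (λ x y →
      con (½ ℚ.* 1ℚ) :* x :+ (con (½ ℚ.* 1ℚ) :* y :+ con 0ℚ) := con ½ :* (x :+ y)) refl

  ⟪πU⟫ : ∀ H → ⟪ πU , H ⟫ ≡ ⅓ ℚ.* (H I₂ ℚ.+ H U ℚ.+ H (U · U))
  ⟪πU⟫ H = expand (H I₂) (H U) (H (U · U))
    where
    expand : ∀ x y z → ⅓ ℚ.* 1ℚ ℚ.* x ℚ.+ (⅓ ℚ.* 1ℚ ℚ.* y ℚ.+ (⅓ ℚ.* 1ℚ ℚ.* z ℚ.+ 0ℚ))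
                      ≡ ⅓ ℚ.* (x ℚ.+ y ℚ.+ z)
    expand = solve 3 (λ x y z →
      con (⅓ ℚ.* 1ℚ) :* x :+ (con (⅓ ℚ.* 1ℚ) :* y :+ (con (⅓ ℚ.* 1ℚ) :* z :+ con 0ℚ))
        := con ⅓ :* (x :+ y :+ z)) refl

  ½[x+y]≡½[y+x] : ∀ x y → ½ ℚ.* (x ℚ.+ y) ≡ ½ ℚ.* (y ℚ.+ x)
  ½[x+y]≡½[y+x] = solve 2 (λ x y → con ½ :* (x :+ y) := con ½ :* (y :+ x)) refl

  ⅓[y+z+x]≡⅓[x+y+z] : ∀ x y z → ⅓ ℚ.* (y ℚ.+ z ℚ.+ x) ≡ ⅓ ℚ.* (x ℚ.+ y ℚ.+ z)
  ⅓[y+z+x]≡⅓[x+y+z] = solve 3 (λ x y z → con ⅓ :* (y :+ z :+ x) := con ⅓ :* (x :+ y :+ z)) refl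

  ½[x+x]≡x : ∀ x → ½ ℚ.* (x ℚ.+ x) ≡ x
  ½[x+x]≡x = solve 1 (λ x → con ½ :* (x :+ x) := x) refl

  ⅓[x+x+x]≡x : ∀ x → ⅓ ℚ.* (x ℚ.+ x ℚ.+ x) ≡ x
  ⅓[x+x+x]≡x = solve 1 (λ x → con ⅓ :* (x :+ x :+ x) := x) refl

S²∼I : S · S ∼ I₂
S²∼I = opposite refl

U³∼I : U · (U · U) ∼ I₂
U³∼I = opposite refl

S·-fixes-⟪πS⟫ : ∀ H → Respects∼ H → ⟪ πS , H ∘ (S ·_) ⟫ ≡ ⟪ πS , H ⟫
S·-fixes-⟪πS⟫ H H-resp = begin
  ⟪ πS , H ∘ (S ·_) ⟫
    ≡⟨ ⟪πS⟫ (H ∘ (S ·_)) ⟩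
  ½ ℚ.* (H (S · I₂) ℚ.+ H (S · S))
    ≡⟨ cong₂ (λ x y → ½ ℚ.* (x ℚ.+ y)) (H-resp (·-identityʳ S)) (H-resp S²∼I) ⟩
  ½ ℚ.* (H S ℚ.+ H I₂)
    ≡⟨ ½[x+y]≡½[y+x] (H S) (H I₂) ⟩
  ½ ℚ.* (H I₂ ℚ.+ H S)
    ≡⟨ ⟪πS⟫ H ⟨
  ⟪ πS , H ⟫ ∎
  where open ≡-Reasoning

U·-fixes-⟪πU⟫ : ∀ H → Respects∼ H → ⟪ πU , H ∘ (U ·_) ⟫ ≡ ⟪ πU , H ⟫
U·-fixes-⟪πU⟫ H H-resp = begin
  ⟪ πU , H ∘ (U ·_) ⟫
    ≡⟨ ⟪πU⟫ (H ∘ (U ·_)) ⟩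
  ⅓ ℚ.* (H (U · I₂) ℚ.+ H (U · U) ℚ.+ H (U · (U · U)))
    ≡⟨ cong₂ (λ x z → ⅓ ℚ.* (x ℚ.+ H (U · U) ℚ.+ z)) (H-resp (·-identityʳ U)) (H-resp U³∼I) ⟩
  ⅓ ℚ.* (H U ℚ.+ H (U · U) ℚ.+ H I₂)
    ≡⟨ ⅓[y+z+x]≡⅓[x+y+z] (H I₂) (H U) (H (U · U)) ⟩
  ⅓ ℚ.* (H I₂ ℚ.+ H U ℚ.+ H (U · U))
    ≡⟨ ⟪πU⟫ H ⟨
  ⟪ πU , H ⟫ ∎
  where open ≡-Reasoning

coeff-ι⊛ : ∀ g ξ m → coeff (ι g ⊛ ξ) m ≡ ⟪ ξ , δ m ∘ (g ·_) ⟫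
coeff-ι⊛ g ξ m = trans (coeff-⊛ (ι g) ξ m) (⟪ι⟫ g (λ s → ⟪ ξ , δ m ∘ (s ·_) ⟫))

ιS⊛πS≈πS : ι S ⊛ πS ≈ πS
ιS⊛πS≈πS m = trans (coeff-ι⊛ S πS m) (trans (S·-fixes-⟪πS⟫ (δ m) (δ-resp m)) (sym (coeff≡⟪δ⟫ πS m)))

ιU⊛πU≈πU : ι U ⊛ πU ≈ πU
ιU⊛πU≈πU m = trans (coeff-ι⊛ U πU m) (trans (U·-fixes-⟪πU⟫ (δ m) (δ-resp m)) (sym (coeff≡⟪δ⟫ πU m)))

⟪⟫-δ∘I₂· : ∀ ξ m → ⟪ ξ , δ m ∘ (I₂ ·_) ⟫ ≡ ⟪ ξ , δ m ⟫
⟪⟫-δ∘I₂· ξ m = ⟪⟫-cong ξ (λ t → δ-resp m (·-identityˡ t))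

πS-idem : πS ⊛ πS ≈ πS
πS-idem m = begin
  coeff (πS ⊛ πS) m
    ≡⟨ coeff-⊛ πS πS m ⟩
  ⟪ πS , (λ s → ⟪ πS , δ m ∘ (s ·_) ⟫) ⟫
    ≡⟨ ⟪πS⟫ (λ s → ⟪ πS , δ m ∘ (s ·_) ⟫) ⟩
  ½ ℚ.* (⟪ πS , δ m ∘ (I₂ ·_) ⟫ ℚ.+ ⟪ πS , δ m ∘ (S ·_) ⟫)
    ≡⟨ cong₂ (λ x y → ½ ℚ.* (x ℚ.+ y)) (⟪⟫-δ∘I₂· πS m) (S·-fixes-⟪πS⟫ (δ m) (δ-resp m)) ⟩
  ½ ℚ.* (⟪ πS , δ m ⟫ ℚ.+ ⟪ πS , δ m ⟫)
    ≡⟨ ½[x+x]≡x ⟪ πS , δ m ⟫ ⟩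
  ⟪ πS , δ m ⟫
    ≡⟨ coeff≡⟪δ⟫ πS m ⟨
  coeff πS m ∎
  where open ≡-Reasoning

πU-idem : πU ⊛ πU ≈ πU
πU-idem m = begin
  coeff (πU ⊛ πU) m
    ≡⟨ coeff-⊛ πU πU m ⟩
  ⟪ πU , (λ s → ⟪ πU , δ m ∘ (s ·_) ⟫) ⟫
    ≡⟨ ⟪πU⟫ (λ s → ⟪ πU , δ m ∘ (s ·_) ⟫) ⟩
  ⅓ ℚ.* (⟪ πU , δ m ∘ (I₂ ·_) ⟫ ℚ.+ ⟪ πU , δ m ∘ (U ·_) ⟫ ℚ.+ ⟪ πU , δ m ∘ ((U · U) ·_) ⟫)
    ≡⟨ cong₃ (λ x y z → ⅓ ℚ.* (x ℚ.+ y ℚ.+ z)) (⟪⟫-δ∘I₂· πU m) U·-step U²·-step ⟩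
  ⅓ ℚ.* (⟪ πU , δ m ⟫ ℚ.+ ⟪ πU , δ m ⟫ ℚ.+ ⟪ πU , δ m ⟫)
    ≡⟨ ⅓[x+x+x]≡x ⟪ πU , δ m ⟫ ⟩
  ⟪ πU , δ m ⟫
    ≡⟨ coeff≡⟪δ⟫ πU m ⟨
  coeff πU m ∎
  where
  open ≡-Reasoning
  U·-step : ⟪ πU , δ m ∘ (U ·_) ⟫ ≡ ⟪ πU , δ m ⟫
  U·-step = U·-fixes-⟪πU⟫ (δ m) (δ-resp m)
  U²·-step : ⟪ πU , δ m ∘ ((U · U) ·_) ⟫ ≡ ⟪ πU , δ m ⟫
  U²·-step = trans (⟪⟫-cong πU (λ t → δ-resp m (·-assoc U U t)))
                   (trans (U·-fixes-⟪πU⟫ (δ m ∘ (U ·_)) (δ-resp m ∘ ·-congˡ U)) U·-step)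
  cong₃ : ∀ (f : ℚ → ℚ → ℚ → ℚ) {x x′ y y′ z z′} → x ≡ x′ → y ≡ y′ → z ≡ z′ → f x y z ≡ f x′ y′ z′
  cong₃ f refl refl refl = refl

-- πS𝓡 ∩ πU𝓡 = 0

-- (S·U)² = [[1,0],[-2,1]]: shear keeps the first row and subtracts twice it from the second.
-- It is opaque: conversion checking would otherwise unfold products of concrete matrices (slow).
opaque
  shear : Mat → Mat
  shear m = S · (U · (S · (U · m)))

  shear-unfold : ∀ m → shear m ≡ S · (U · (S · (U · m)))
  shear-unfold m = refl

shear^ : ℕ → Mat → Mat
shear^ zero    m = m
shear^ (suc k) m = shear (shear^ k m)

shear⁴ : ℕ → ℤ⁴ → ℤ⁴
shear⁴ k (a , b , c , d) = a , b , c ℤ.- + k ℤ.* (a ℤ.+ a) , d ℤ.- + k ℤ.* (b ℤ.+ b)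

module _ where
  open ℤSolver.+-*-Solver

  SU⁴ : ℤ⁴ → ℤ⁴
  SU⁴ (a , b , c , d) = ℤ.- a , ℤ.- b , a ℤ.- c , b ℤ.- d

  entries-SU : ∀ m → entries (S · (U · m)) ≡ SU⁴ (entries m)
  entries-SU m = ≡⁴ (first (Mat.a m) (Mat.c m)) (first (Mat.b m) (Mat.d m))
                    (second (Mat.a m) (Mat.c m)) (second (Mat.b m) (Mat.d m))
    where
    first : ∀ x y → + 0 ℤ.* (+ 1 ℤ.* x ℤ.+ ℤ.-[1+ 0 ] ℤ.* y) ℤ.+ ℤ.-[1+ 0 ] ℤ.* (+ 1 ℤ.* x ℤ.+ + 0 ℤ.* y)
                    ≡ ℤ.- x
    first = solve 2 (λ x y → con (+ 0) :* (con (+ 1) :* x :+ con ℤ.-[1+ 0 ] :* y)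
                             :+ con ℤ.-[1+ 0 ] :* (con (+ 1) :* x :+ con (+ 0) :* y) := :- x) refl
    second : ∀ x y → + 1 ℤ.* (+ 1 ℤ.* x ℤ.+ ℤ.-[1+ 0 ] ℤ.* y) ℤ.+ + 0 ℤ.* (+ 1 ℤ.* x ℤ.+ + 0 ℤ.* y)
                     ≡ x ℤ.- y
    second = solve 2 (λ x y → con (+ 1) :* (con (+ 1) :* x :+ con ℤ.-[1+ 0 ] :* y)
                              :+ con (+ 0) :* (con (+ 1) :* x :+ con (+ 0) :* y) := x :- y) refl

  SU⁴∘SU⁴∘shear⁴ : ∀ k x → SU⁴ (SU⁴ (shear⁴ k x)) ≡ shear⁴ (suc k) x
  SU⁴∘SU⁴∘shear⁴ k (a , b , c , d) =
    ≡⁴ (ℤP.neg-involutive a) (ℤP.neg-involutive b) (step c a (+ k)) (step d b (+ k))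
    where
    step : ∀ c a k → ℤ.- a ℤ.- (a ℤ.- (c ℤ.- k ℤ.* (a ℤ.+ a))) ≡ c ℤ.- (+ 1 ℤ.+ k) ℤ.* (a ℤ.+ a)
    step = solve 3 (λ c a k →
      :- a :- (a :- (c :- k :* (a :+ a))) := c :- (con (+ 1) :+ k) :* (a :+ a)) refl

  shear⁴-zero : ∀ x → x ≡ shear⁴ zero x
  shear⁴-zero (a , b , c , d) = ≡⁴ refl refl (x≡x-0*y c a) (x≡x-0*y d b)
    where
    x≡x-0*y : ∀ x y → x ≡ x ℤ.- + 0 ℤ.* (y ℤ.+ y)
    x≡x-0*y = solve 2 (λ x y → x := x :- con (+ 0) :* (y :+ y)) refl

  x≡c-[c-x] : ∀ c x → x ≡ c ℤ.- (c ℤ.- x)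
  x≡c-[c-x] = solve 2 (λ c x → x := c :- (c :- x)) refl

  2*x≡x+x : ∀ x → + 2 ℤ.* x ≡ x ℤ.+ x
  2*x≡x+x = solve 1 (λ x → con (+ 2) :* x := x :+ x) refl

entries-shear^ : ∀ k m → entries (shear^ k m) ≡ shear⁴ k (entries m)
entries-shear^ zero    m = shear⁴-zero (entries m)
entries-shear^ (suc k) m = begin
  entries (shear (shear^ k m))           ≡⟨ cong entries (shear-unfold (shear^ k m)) ⟩
  entries (S · (U · (S · (U · shear^ k m)))) ≡⟨ entries-SU (S · (U · shear^ k m)) ⟩
  SU⁴ (entries (S · (U · shear^ k m)))    ≡⟨ cong SU⁴ (entries-SU (shear^ k m)) ⟩
  SU⁴ (SU⁴ (entries (shear^ k m)))        ≡⟨ cong (SU⁴ ∘ SU⁴) (entries-shear^ k m) ⟩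
  SU⁴ (SU⁴ (shear⁴ k (entries m)))        ≡⟨ SU⁴∘SU⁴∘shear⁴ k (entries m) ⟩
  shear⁴ (suc k) (entries m)             ∎
  where open ≡-Reasoning

∣row₂∣ : Mat → ℕ
∣row₂∣ m = ∣ Mat.c m ∣ ℕ.+ ∣ Mat.d m ∣

max∣row₂∣ : R → ℕ
max∣row₂∣ []            = 0
max∣row₂∣ ((_ , n) ∷ ξ) = ∣row₂∣ n ℕ.⊔ max∣row₂∣ ξ

shear-growth : ∀ {k} → ∣ k ∣ ≢ 0 → ∀ N c c′ →
               c′ ≡ c ℤ.- + N ℤ.* k ⊎ c′ ≡ ℤ.- (c ℤ.- + N ℤ.* k) → N ℕ.≤ ∣ c ∣ ℕ.+ ∣ c′ ∣
shear-growth {k} ∣k∣≢0 N c c′ c′≡ = begin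
  N                                  ≤⟨ ℕP.m≤m*n N ∣ k ∣ {{ℕ.≢-nonZero ∣k∣≢0}} ⟩
  N ℕ.* ∣ k ∣                         ≡⟨ ℤP.abs-* (+ N) k ⟨
  ∣ + N ℤ.* k ∣                       ≡⟨ cong ∣_∣ (x≡c-[c-x] c (+ N ℤ.* k)) ⟩
  ∣ c ℤ.- (c ℤ.- + N ℤ.* k) ∣         ≤⟨ ℤP.∣i-j∣≤∣i∣+∣j∣ c (c ℤ.- + N ℤ.* k) ⟩
  ∣ c ∣ ℕ.+ ∣ c ℤ.- + N ℤ.* k ∣        ≡⟨ cong (∣ c ∣ ℕ.+_) (∣c′∣ c′≡) ⟨
  ∣ c ∣ ℕ.+ ∣ c′ ∣                     ∎
  where
  open ℕP.≤-Reasoning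
  ∣c′∣ : c′ ≡ c ℤ.- + N ℤ.* k ⊎ c′ ≡ ℤ.- (c ℤ.- + N ℤ.* k) → ∣ c′ ∣ ≡ ∣ c ℤ.- + N ℤ.* k ∣
  ∣c′∣ (inj₁ eq) = cong ∣_∣ eq
  ∣c′∣ (inj₂ eq) = trans (cong ∣_∣ eq) (ℤP.∣-i∣≡∣i∣ (c ℤ.- + N ℤ.* k))

∣x+x∣≢0 : ∀ {x} → x ≢ 0ℤ → ∣ x ℤ.+ x ∣ ≢ 0
∣x+x∣≢0 {x} x≢0 ∣x+x∣≡0 with ℤP.i*j≡0⇒i≡0∨j≡0 (+ 2) (trans (2*x≡x+x x) (ℤP.∣i∣≡0⇒i≡0 ∣x+x∣≡0))
... | inj₂ x≡0 = x≢0 x≡0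

first-row≢0 : ∀ m → Mat.a m ≡ 0ℤ → Mat.b m ≡ 0ℤ → ⊥
first-row≢0 (mat a b c d detPos) refl refl = ℤP.<-irrefl refl detPos

far-from-shear : ∀ m n N → ∣row₂∣ m ℕ.+ ∣row₂∣ n ℕ.< N → ¬ n ∼ shear^ N m
far-from-shear m n N bound n∼ with Mat.a m ℤ.≟ 0ℤ | Mat.b m ℤ.≟ 0ℤ
... | yes a≡0 | yes b≡0 = first-row≢0 m a≡0 b≡0
... | no a≢0  | _       = ℕP.<⇒≱ bound (ℕP.≤-trans
  (shear-growth (∣x+x∣≢0 a≢0) N (Mat.c m) (Mat.c n) (third-entry n∼))
  (ℕP.+-mono-≤ (ℕP.m≤m+n ∣ Mat.c m ∣ ∣ Mat.d m ∣) (ℕP.m≤m+n ∣ Mat.c n ∣ ∣ Mat.d n ∣)))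
  where
  third-entry : n ∼ shear^ N m → Mat.c n ≡ Mat.c m ℤ.- + N ℤ.* (Mat.a m ℤ.+ Mat.a m)
                                ⊎ Mat.c n ≡ ℤ.- (Mat.c m ℤ.- + N ℤ.* (Mat.a m ℤ.+ Mat.a m))
  third-entry (same eq)     = inj₁ (cong entry₃ (trans eq (entries-shear^ N m)))
  third-entry (opposite eq) = inj₂ (cong entry₃ (trans eq (cong -⁴_ (entries-shear^ N m))))
... | yes _   | no b≢0  = ℕP.<⇒≱ bound (ℕP.≤-trans
  (shear-growth (∣x+x∣≢0 b≢0) N (Mat.d m) (Mat.d n) (fourth-entry n∼))
  (ℕP.+-mono-≤ (ℕP.m≤n+m ∣ Mat.d m ∣ ∣ Mat.c m ∣) (ℕP.m≤n+m ∣ Mat.d n ∣ ∣ Mat.c n ∣)))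
  where
  fourth-entry : n ∼ shear^ N m → Mat.d n ≡ Mat.d m ℤ.- + N ℤ.* (Mat.b m ℤ.+ Mat.b m)
                                 ⊎ Mat.d n ≡ ℤ.- (Mat.d m ℤ.- + N ℤ.* (Mat.b m ℤ.+ Mat.b m))
  fourth-entry (same eq)     = inj₁ (cong entry₄ (trans eq (entries-shear^ N m)))
  fourth-entry (opposite eq) = inj₂ (cong entry₄ (trans eq (cong -⁴_ (entries-shear^ N m))))

coeff-far : ∀ ξ m N → ∣row₂∣ m ℕ.+ max∣row₂∣ ξ ℕ.< N → coeff ξ (shear^ N m) ≡ 0ℚ
coeff-far []            m N _     = refl
coeff-far ((q , n) ∷ ξ) m N bound with sameM n (shear^ N m) in n∼?
... | true  = ⊥-elim (far-from-shear m n N (bound-for (ℕP.m≤m⊔n (∣row₂∣ n) (max∣row₂∣ ξ)))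
                        (Equivalence.to (sameM⇔∼ n (shear^ N m)) n∼?))
  where
  bound-for : ∀ {k} → k ℕ.≤ ∣row₂∣ n ℕ.⊔ max∣row₂∣ ξ → ∣row₂∣ m ℕ.+ k ℕ.< N
  bound-for k≤ = ℕP.≤-<-trans (ℕP.+-monoʳ-≤ (∣row₂∣ m) k≤) bound
... | false = trans (ℚP.+-identityˡ (coeff ξ (shear^ N m))) (coeff-far ξ m N bound′)
  where
  bound′ : ∣row₂∣ m ℕ.+ max∣row₂∣ ξ ℕ.< N
  bound′ = ℕP.≤-<-trans (ℕP.+-monoʳ-≤ (∣row₂∣ m) (ℕP.m≤n⊔m (∣row₂∣ n) (max∣row₂∣ ξ))) bound

coeff-translate : ∀ g x → ι g ⊛ x ≈ x → ∀ m → coeff x (g · m) ≡ coeff x m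
coeff-translate g x gx≈x m = begin
  coeff x (g · m)              ≡⟨ gx≈x (g · m) ⟨
  coeff (ι g ⊛ x) (g · m)      ≡⟨ coeff-ι⊛ g x (g · m) ⟩
  ⟪ x , δ (g · m) ∘ (g ·_) ⟫   ≡⟨ ⟪⟫-cong x (λ t → cong 𝟙 (sameM-cancelˡ g t m)) ⟩
  ⟪ x , δ m ⟫                  ≡⟨ coeff≡⟪δ⟫ x m ⟨
  coeff x m                    ∎
  where open ≡-Reasoning

coeff-shear^ : ∀ x → ι S ⊛ x ≈ x → ι U ⊛ x ≈ x → ∀ N m → coeff x (shear^ N m) ≡ coeff x m
coeff-shear^ x Sx≈x Ux≈x zero    m = refl
coeff-shear^ x Sx≈x Ux≈x (suc N) m = begin
  coeff x (shear n)                   ≡⟨ cong (coeff x) (shear-unfold n) ⟩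
  coeff x (S · (U · (S · (U · n))))   ≡⟨ coeff-translate S x Sx≈x (U · (S · (U · n))) ⟩
  coeff x (U · (S · (U · n)))         ≡⟨ coeff-translate U x Ux≈x (S · (U · n)) ⟩
  coeff x (S · (U · n))               ≡⟨ coeff-translate S x Sx≈x (U · n) ⟩
  coeff x (U · n)                     ≡⟨ coeff-translate U x Ux≈x n ⟩
  coeff x n                           ≡⟨ coeff-shear^ x Sx≈x Ux≈x N m ⟩
  coeff x m                           ∎
  where
  open ≡-Reasoning
  n = shear^ N m

open RightIdeals 𝓡-ring using (*-fixes-∈𝑅; module TwoIdempotents)

πS𝓡∩πU𝓡≈0 : ∀ x → x ∈ πS 𝓡 → x ∈ πU 𝓡 → x ≈ 0R
πS𝓡∩πU𝓡≈0 x x∈πS𝓡 x∈πU𝓡 m =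
  trans (sym (coeff-shear^ x Sx≈x Ux≈x N m)) (coeff-far x m N (ℕP.n<1+n (∣row₂∣ m ℕ.+ max∣row₂∣ x)))
  where
  N : ℕ
  N = suc (∣row₂∣ m ℕ.+ max∣row₂∣ x)
  Sx≈x : ι S ⊛ x ≈ x
  Sx≈x = *-fixes-∈𝑅 {ι S} {πS} x ιS⊛πS≈πS x∈πS𝓡
  Ux≈x : ι U ⊛ x ≈ x
  Ux≈x = *-fixes-∈𝑅 {ι U} {πU} x ιU⊛πU≈πU x∈πU𝓡

open TwoIdempotents πS πU πS-idem πU-idem πS𝓡∩πU𝓡≈0

lemma3 :
  -- existence and uniqueness of (ξ_S , ξ_U) for ξ ∈ 𝓐
  ((ξ : R) → 𝓐 ξ →
    Σ (R × R) λ p → IsDecomp ξ (proj₁ p) (proj₂ p) ×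
      ((ξS' ξU' : R) → IsDecomp ξ ξS' ξU' → (ξS' ≈ proj₁ p) × (ξU' ≈ proj₂ p)))
  ×
  -- the map P(ξ) = ξ - ξ_S - ξ_U on 𝓐
  (Σ ((ξ : R) → 𝓐 ξ → R) λ P →
    ((ξ : R) (a : 𝓐 ξ) (ξS ξU : R) → IsDecomp ξ ξS ξU → P ξ a ≈ ξ ⊝ ξS ⊝ ξU)
    -- P maps 𝓐 to 𝓐
    × ((ξ : R) (a : 𝓐 ξ) → 𝓐 (P ξ a))
    -- P is idempotent
    × ((ξ : R) (a : 𝓐 ξ) (a' : 𝓐 (P ξ a)) → P (P ξ a) a' ≈ P ξ a)
    -- the image of P lies in 𝓑
    × ((ξ : R) (a : 𝓐 ξ) → 𝓑 (P ξ a))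
    -- 𝓑 ⊆ 𝓐 and P is the identity on 𝓑 (so the image is exactly 𝓑)
    × ((ξ : R) → 𝓑 ξ → Σ (𝓐 ξ) λ a → P ξ a ≈ ξ)
    -- P(𝓘) ⊆ 𝓙 (in particular 𝓘 ⊆ 𝓐)
    × ((ξ : R) → 𝓘 ξ → Σ (𝓐 ξ) λ a → 𝓙 (P ξ a))
    -- 𝓙 ⊆ P(𝓘)
    × ((η : R) → 𝓙 η → ∃[ ξ ] (𝓘 ξ × (Σ (𝓐 ξ) λ a → P ξ a ≈ η))))
lemma3 =
  (λ ξ a → decompose {ξ} a , decompose-correct {ξ} a ,
           λ ξS ξU d → decomposition-unique {ξ} {ξS} {ξU} d (decompose-correct {ξ} a)) ,
  P ,
  (λ ξ a ξS ξU → P≈ {ξ} {ξS} {ξU} a) ,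
  (λ ξ a → ℬ⇒𝒜 {P ξ a} (P-ℬ {ξ} a)) ,
  (λ ξ → P-idem {ξ}) ,
  (λ ξ → P-ℬ {ξ}) ,
  (λ ξ b → ℬ⇒𝒜 {ξ} b , P-fixes-ℬ {ξ} b (ℬ⇒𝒜 {ξ} b)) ,
  (λ ξ i → ℐ⇒𝒜 {ξ} i , P-ℐ {ξ} i (ℐ⇒𝒜 {ξ} i)) ,
  (λ η j → η , 𝒥⇒ℐ {η} j , ℬ⇒𝒜 {η} (𝒥⇒ℬ {η} j) ,
           P-fixes-ℬ {η} (𝒥⇒ℬ {η} j) (ℬ⇒𝒜 {η} (𝒥⇒ℬ {η} j)))
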